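{- For any finite set $\Phi$ of propositions over $\mathrm{At}$ and proposition $\psi$ over $\mathrm{At}$: if $\Phi \Vdash_{\mathcal{N}} \psi$, then $\Phi \vdash \psi$ is provable in intuitionistic propositional logic.
   Context: Fix a countably infinite set $\mathrm{At}$ of atoms; propositions over $\mathrm{At}$ are built from atoms, $\top$, $\bot$ using $\wedge, \vee, \supset$. For every non-atomic proposition $\phi$ over $\mathrm{At}$ introduce a fresh atom $\phi^\flat$, and for $a \in \mathrm{At}$ put $a^\flat = a$; let $\mathrm{At}^* = \{\phi^\flat\}$ and $\Gamma^\flat = \{\gamma^\flat \mid \gamma \in \Gamma\}$. An atomic rule has the form $((P_1 \Rightarrow a_1), \dots, (P_n \Rightarrow a_n) \Rightarrow b)$ with $n \ge 0$, atoms $a_i, b \in \mathrm{At}^*$ and finite sets $P_i \subseteq \mathrm{At}^*$; a base is a set of atomic rules, ordered by inclusion. Derivability $P \vdash_{\mathcal{B}} a$ is defined inductively by (Ref) $P, a \vdash_{\mathcal{B}} a$ and (App) for a rule $((P_1 \Rightarrow a_1),\dots,(P_n \Rightarrow a_n) \Rightarrow b) \in \mathcal{B}$ and finite $Q$, if $Q, P_i \vdash_{\mathcal{B}} a_i$ for all $i$ then $Q \vdash_{\mathcal{B}} b$ (commas denote union). The base $\mathcal{N}$ consists of, for every instance of a rule of intuitionistic natural deduction NJ with premises $\psi_1,\dots,\psi_n$ (with $\Gamma_i$ the hypotheses discharged in the $i$-th premise) and conclusion $\chi$, the atomic rule $((\Gamma_1^\flat \Rightarrow \psi_1^\flat),\dots,(\Gamma_n^\flat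 \Rightarrow \psi_n^\flat) \Rightarrow \chi^\flat)$. Support (with atoms ranging over $\mathrm{At}^*$): $\Vdash_{\mathcal{B}} a$ iff $\emptyset \vdash_{\mathcal{B}} a$; $\Vdash_{\mathcal{B}} \top$ always; $\Vdash_{\mathcal{B}} \phi \wedge \psi$ iff $\Vdash_{\mathcal{B}} \phi$ and $\Vdash_{\mathcal{B}} \psi$; $\Vdash_{\mathcal{B}} \phi \supset \psi$ iff $\phi \Vdash_{\mathcal{B}} \psi$; $\Vdash_{\mathcal{B}} \phi \vee \psi$ iff for every atom $a$ and every base $\mathcal{C} \supseteq \mathcal{B}$, if $\phi \Vdash_{\mathcal{C}} a$ and $\psi \Vdash_{\mathcal{C}} a$ then $\Vdash_{\mathcal{C}} a$; $\Vdash_{\mathcal{B}} \bot$ iff $\Vdash_{\mathcal{B}} a$ for every atom $a$. For nonempty $\Theta$, $\Theta \Vdash_{\mathcal{B}} \phi$ means: for every $\mathcal{C} \supseteq \mathcal{B}$, if $\Vdash_{\mathcal{C}} \theta$ for all $\theta \in \Theta$ then $\Vdash_{\mathcal{C}} \phi$; for $\Theta = \emptyset$ it means $\Vdash_{\mathcal{B}} \phi$. -}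

module Defs where

open import Level using (Lift; lift) renaming (suc to lsuc; zero to lzero)
open import Data.Nat using (ℕ)
open import Data.Product using (_×_; _,_)
open import Data.List using (List; []; _∷_; _++_)
open import Data.List.Relation.Unary.All using (All)
open import Data.List.Membership.Propositional using (_∈_)
open import Data.Unit using (⊤)

At : Set
At = ℕ

infixr 6 _∧_
infixr 5 _∨_
infixr 4 _⊃_

data Form : Set where
  atom : At → Form
  ⊤'   : Form
  ⊥'   : Form
  _∧_  : Form → Form → Form
  _∨_  : Form → Form → Form
  _⊃_  : Form → Form → Form

-- At* : one atom φ♭ for every proposition φ; for an atom a, a♭ is a
-- itself (the element ♭ (atom a) represents the original atom a), and
-- for non-atomic φ, ♭ φ is a fresh atom (distinct for distinct φ).

data AtStar : Set where
  ♭ : Form → AtStar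

♭s : List Form → List AtStar
♭s []      = []
♭s (γ ∷ Γ) = ♭ γ ∷ ♭s Γ

record Rule : Set where
  constructor _⇒_
  field
    premises   : List (List AtStar × AtStar)
    conclusion : AtStar
open Rule public

Base : Set₁
Base = Rule → Set

_⊆B_ : Base → Base → Set
B ⊆B C = ∀ r → B r → C r

data Der (B : Base) : List AtStar → AtStar → Set where
  ref : ∀ {P a} → a ∈ P → Der B P a
  app : ∀ {Q} (r : Rule) → B r →
        All (λ { (Pᵢ , aᵢ) → Der B (Q ++ Pᵢ) aᵢ }) (premises r) →
        Der B Q (conclusion r)

Supp : Base → Form → Set₁
Supp B (atom a) = Lift (lsuc lzero) (Der B [] (♭ (atom a)))
Supp B ⊤'       = Lift (lsuc lzero) ⊤
Supp B ⊥'       = Lift (lsuc lzero) (∀ (a : AtStar) → Der B [] a)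
Supp B (φ ∧ ψ)  = Supp B φ × Supp B ψ
Supp B (φ ⊃ ψ)  = ∀ (C : Base) → B ⊆B C → Supp C φ → Supp C ψ
Supp B (φ ∨ ψ)  =
  ∀ (a : AtStar) (C : Base) → B ⊆B C →
    (∀ (D : Base) → C ⊆B D → Supp D φ → Der D [] a) →
    (∀ (D : Base) → C ⊆B D → Supp D ψ → Der D [] a) →
    Der C [] a

SuppFrom : List Form → Base → Form → Set₁
SuppFrom []         B φ = Supp B φ
SuppFrom Θ@(_ ∷ _)  B φ = ∀ (C : Base) → B ⊆B C → All (Supp C) Θ → Supp C φ

data 𝒩 : Rule → Set where
  ⊤I  : 𝒩 ([] ⇒ ♭ ⊤')
  ⊥E  : ∀ φ → 𝒩 ((([] , ♭ ⊥') ∷ []) ⇒ ♭ φ)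
  ∧I  : ∀ φ ψ → 𝒩 ((([] , ♭ φ) ∷ ([] , ♭ ψ) ∷ []) ⇒ ♭ (φ ∧ ψ))
  ∧E₁ : ∀ φ ψ → 𝒩 ((([] , ♭ (φ ∧ ψ)) ∷ []) ⇒ ♭ φ)
  ∧E₂ : ∀ φ ψ → 𝒩 ((([] , ♭ (φ ∧ ψ)) ∷ []) ⇒ ♭ ψ)
  ∨I₁ : ∀ φ ψ → 𝒩 ((([] , ♭ φ) ∷ []) ⇒ ♭ (φ ∨ ψ))
  ∨I₂ : ∀ φ ψ → 𝒩 ((([] , ♭ ψ) ∷ []) ⇒ ♭ (φ ∨ ψ))
  ∨E  : ∀ φ ψ χ → 𝒩 ((([] , ♭ (φ ∨ ψ)) ∷ (♭s (φ ∷ []) , ♭ χ)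
                       ∷ (♭s (ψ ∷ []) , ♭ χ) ∷ []) ⇒ ♭ χ)
  ⊃I  : ∀ φ ψ → 𝒩 (((♭s (φ ∷ []) , ♭ ψ) ∷ []) ⇒ ♭ (φ ⊃ ψ))
  ⊃E  : ∀ φ ψ → 𝒩 ((([] , ♭ (φ ⊃ ψ)) ∷ ([] , ♭ φ) ∷ []) ⇒ ♭ ψ)

infix 3 _⊢NJ_
data _⊢NJ_ (Γ : List Form) : Form → Set where
  hyp : ∀ {φ} → φ ∈ Γ → Γ ⊢NJ φ
  ⊤I  : Γ ⊢NJ ⊤'
  ⊥E  : ∀ {φ} → Γ ⊢NJ ⊥' → Γ ⊢NJ φ
  ∧I  : ∀ {φ ψ} → Γ ⊢NJ φ → Γ ⊢NJ ψ → Γ ⊢NJ φ ∧ ψ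
  ∧E₁ : ∀ {φ ψ} → Γ ⊢NJ φ ∧ ψ → Γ ⊢NJ φ
  ∧E₂ : ∀ {φ ψ} → Γ ⊢NJ φ ∧ ψ → Γ ⊢NJ ψ
  ∨I₁ : ∀ {φ ψ} → Γ ⊢NJ φ → Γ ⊢NJ φ ∨ ψ
  ∨I₂ : ∀ {φ ψ} → Γ ⊢NJ ψ → Γ ⊢NJ φ ∨ ψ
  ∨E  : ∀ {φ ψ χ} → Γ ⊢NJ φ ∨ ψ → (φ ∷ Γ) ⊢NJ χ → (ψ ∷ Γ) ⊢NJ χ → Γ ⊢NJ χ
  ⊃I  : ∀ {φ ψ} → (φ ∷ Γ) ⊢NJ ψ → Γ ⊢NJ φ ⊃ ψ
  ⊃E  : ∀ {φ ψ} → Γ ⊢NJ φ ⊃ ψ → Γ ⊢NJ φ → Γ ⊢NJ ψ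

{-# OPTIONS --safe #-}
-- In every base C extending 𝒩, support of φ coincides with derivability of
-- the atom φ♭: the introduction rules of 𝒩 turn support into a derivation,
-- and its elimination rules turn a derivation back into support.  For ⊃ and ∨
-- a hypothesis θ is made available by adding θ♭ to C as an axiom, which is
-- afterwards discharged into the context.  Applied to 𝒩 extended by the axioms
-- Φ♭, this turns Φ ⊩ ψ into Φ♭ ⊢𝒩 ψ♭, and a derivation in 𝒩 is an NJ
-- derivation with every atom φ♭ read as φ.
module Submission where

open import Defs
open import Level using (lift; lower)
open import Data.List using (List; []; _∷_; _++_; _∷ʳ_)
open import Data.List.Relation.Unary.All using (All; []; _∷_; tabulate)
open import Data.List.Relation.Unary.Any using (here; there)
open import Data.List.Membership.Propositional using (_∈_)
open import Data.List.Membership.Propositional.Properties using (∈-++⁻)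
open import Data.List.Relation.Binary.Subset.Propositional using (_⊆_)
open import Data.List.Relation.Binary.Subset.Propositional.Properties
  using (⊆-refl; ⊆-trans; xs⊆xs++ys; ++⁺ˡ)
open import Data.Product using (_×_; _,_)
open import Data.Sum using (_⊎_; inj₁; inj₂; [_,_])
open import Data.Unit using (tt)
open import Function using (_∘_)
open import Relation.Binary.PropositionalEquality using (refl)

⊆-++[] : {A : Set} {xs ys : List A} → xs ⊆ ys → xs ++ [] ⊆ ys
⊆-++[] {xs = xs} xs⊆ys m = [ xs⊆ys , (λ ()) ] (∈-++⁻ xs m)

⊆-∷ʳ : {A : Set} {xs ys : List A} {y : A} → xs ⊆ ys → xs ∷ʳ y ⊆ y ∷ ys
⊆-∷ʳ {xs = xs} xs⊆ys m = [ there ∘ xs⊆ys , (λ { (here refl) → here refl }) ] (∈-++⁻ xs m)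

∈-♭s⁺ : ∀ {φ Γ} → φ ∈ Γ → ♭ φ ∈ ♭s Γ
∈-♭s⁺ (here refl) = here refl
∈-♭s⁺ (there m)   = there (∈-♭s⁺ m)

∈-♭s⁻ : ∀ {φ Γ} → ♭ φ ∈ ♭s Γ → φ ∈ Γ
∈-♭s⁻ {Γ = _ ∷ _} (here refl) = here refl
∈-♭s⁻ {Γ = _ ∷ _} (there m)   = there (∈-♭s⁻ m)

⊆B-refl : ∀ {B} → B ⊆B B
⊆B-refl _ b = b

⊆B-trans : ∀ {B C D} → B ⊆B C → C ⊆B D → B ⊆B D
⊆B-trans B⊆C C⊆D r b = C⊆D r (B⊆C r b)

Premise : Base → List AtStar → List AtStar × AtStar → Set
Premise B Q (P , a) = Der B (Q ++ P) a

mutual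
  Der-mono : ∀ {B C Q a} → B ⊆B C → Der B Q a → Der C Q a
  Der-mono B⊆C (ref m)      = ref m
  Der-mono B⊆C (app r b ds) = app r (B⊆C r b) (Premises-mono B⊆C ds)

  Premises-mono : ∀ {B C Q rs} → B ⊆B C → All (Premise B Q) rs → All (Premise C Q) rs
  Premises-mono B⊆C []       = []
  Premises-mono B⊆C (d ∷ ds) = Der-mono B⊆C d ∷ Premises-mono B⊆C ds

data Axiom (P : List AtStar) : Rule → Set where
  axiom : ∀ {a} → a ∈ P → Axiom P ([] ⇒ a)

infixl 5 _⊕_
_⊕_ : Base → List AtStar → Base
(B ⊕ P) r = B r ⊎ Axiom P r

⊆B-⊕ : ∀ {B P} → B ⊆B (B ⊕ P)
⊆B-⊕ _ = inj₁

Der-axiom : ∀ {B P Q a} → a ∈ P → Der (B ⊕ P) Q a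
Der-axiom m = app _ (inj₂ (axiom m)) []

mutual
  Der-discharge : ∀ {B P Q Q′ a} → Der (B ⊕ P) Q a → Q ⊆ Q′ → P ⊆ Q′ → Der B Q′ a
  Der-discharge (ref m)                     Q⊆Q′ P⊆Q′ = ref (Q⊆Q′ m)
  Der-discharge (app _ (inj₂ (axiom m)) []) Q⊆Q′ P⊆Q′ = ref (P⊆Q′ m)
  Der-discharge (app r (inj₁ b) ds)         Q⊆Q′ P⊆Q′ =
    app r b (Premises-discharge ds Q⊆Q′ P⊆Q′)

  Premises-discharge : ∀ {B P Q Q′ rs} → All (Premise (B ⊕ P) Q) rs →
                       Q ⊆ Q′ → P ⊆ Q′ → All (Premise B Q′) rs
  Premises-discharge []       Q⊆Q′ P⊆Q′ = []
  Premises-discharge {Q′ = Q′} {(Pᵢ , _) ∷ _} (d ∷ ds) Q⊆Q′ P⊆Q′ =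
    Der-discharge d (++⁺ˡ Pᵢ Q⊆Q′) (⊆-trans P⊆Q′ (xs⊆xs++ys Q′ Pᵢ))
    ∷ Premises-discharge ds Q⊆Q′ P⊆Q′

Der-discharge₀ : ∀ {B P a} → Der (B ⊕ P) [] a → Der B P a
Der-discharge₀ d = Der-discharge d (λ ()) ⊆-refl

Supp⇒Der : ∀ φ {C} → 𝒩 ⊆B C → Supp C φ → Der C [] (♭ φ)
Der⇒Supp : ∀ φ {C} → 𝒩 ⊆B C → Der C [] (♭ φ) → Supp C φ
Supp-hyp⇒Der : ∀ θ {C a} → 𝒩 ⊆B C →
               (∀ D → C ⊆B D → Supp D θ → Der D [] a) → Der C (♭ θ ∷ []) a

Supp⇒Der (atom _) 𝒩⊆C s         = lower s
Supp⇒Der ⊤'       𝒩⊆C _         = app _ (𝒩⊆C _ ⊤I) []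
Supp⇒Der ⊥'       𝒩⊆C s         = lower s (♭ ⊥')
Supp⇒Der (φ ∧ ψ)  𝒩⊆C (sφ , sψ) =
  app _ (𝒩⊆C _ (∧I φ ψ)) (Supp⇒Der φ 𝒩⊆C sφ ∷ Supp⇒Der ψ 𝒩⊆C sψ ∷ [])
Supp⇒Der (φ ∨ ψ) {C} 𝒩⊆C s    = s _ _ ⊆B-refl (inject φ (∨I₁ φ ψ)) (inject ψ (∨I₂ φ ψ))
  where
  inject : ∀ θ → 𝒩 ((([] , ♭ θ) ∷ []) ⇒ ♭ (φ ∨ ψ)) →
           ∀ D → C ⊆B D → Supp D θ → Der D [] (♭ (φ ∨ ψ))
  inject θ ∨I D C⊆D sθ = app _ (𝒩⊆D _ ∨I) (Supp⇒Der θ 𝒩⊆D sθ ∷ [])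
    where
    𝒩⊆D : 𝒩 ⊆B D
    𝒩⊆D = ⊆B-trans 𝒩⊆C C⊆D
Supp⇒Der (φ ⊃ ψ)  𝒩⊆C s         = app _ (𝒩⊆C _ (⊃I φ ψ))
  (Supp-hyp⇒Der φ 𝒩⊆C (λ D C⊆D sφ → Supp⇒Der ψ (⊆B-trans 𝒩⊆C C⊆D) (s D C⊆D sφ)) ∷ [])

Der⇒Supp (atom _) 𝒩⊆C d = lift d
Der⇒Supp ⊤'       𝒩⊆C _ = lift tt
Der⇒Supp ⊥'       𝒩⊆C d = lift λ { (♭ χ) → app _ (𝒩⊆C _ (⊥E χ)) (d ∷ []) }
Der⇒Supp (φ ∧ ψ)  𝒩⊆C d =
  Der⇒Supp φ 𝒩⊆C (app _ (𝒩⊆C _ (∧E₁ φ ψ)) (d ∷ [])) ,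
  Der⇒Supp ψ 𝒩⊆C (app _ (𝒩⊆C _ (∧E₂ φ ψ)) (d ∷ []))
Der⇒Supp (φ ∨ ψ)  𝒩⊆C d (♭ χ) D C⊆D φ⊩χ ψ⊩χ =
  app _ (𝒩⊆D _ (∨E φ ψ χ))
    (Der-mono C⊆D d ∷ Supp-hyp⇒Der φ 𝒩⊆D φ⊩χ ∷ Supp-hyp⇒Der ψ 𝒩⊆D ψ⊩χ ∷ [])
  where
  𝒩⊆D : 𝒩 ⊆B D
  𝒩⊆D = ⊆B-trans 𝒩⊆C C⊆D
Der⇒Supp (φ ⊃ ψ)  𝒩⊆C d D C⊆D sφ =
  Der⇒Supp ψ 𝒩⊆D (app _ (𝒩⊆D _ (⊃E φ ψ)) (Der-mono C⊆D d ∷ Supp⇒Der φ 𝒩⊆D sφ ∷ []))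
  where
  𝒩⊆D : 𝒩 ⊆B D
  𝒩⊆D = ⊆B-trans 𝒩⊆C C⊆D

Supp-hyp⇒Der θ {C} 𝒩⊆C θ⊩a = Der-discharge₀
  (θ⊩a _ ⊆B-⊕ (Der⇒Supp θ (⊆B-trans 𝒩⊆C ⊆B-⊕) (Der-axiom {C} (here refl))))

Supp-axioms : ∀ {C} Φ → 𝒩 ⊆B C → All (Supp (C ⊕ ♭s Φ)) Φ
Supp-axioms {C} Φ 𝒩⊆C =
  tabulate λ {φ} φ∈Φ → Der⇒Supp φ (⊆B-trans 𝒩⊆C ⊆B-⊕) (Der-axiom {C} (∈-♭s⁺ φ∈Φ))

Der𝒩⇒NJ : ∀ {P Γ ψ} → Der 𝒩 P (♭ ψ) → P ⊆ ♭s Γ → Γ ⊢NJ ψ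
Der𝒩⇒NJ (ref m)                               P⊆Γ = hyp (∈-♭s⁻ (P⊆Γ m))
Der𝒩⇒NJ (app _ ⊤I [])                         P⊆Γ = ⊤I
Der𝒩⇒NJ (app _ (⊥E _) (d ∷ []))               P⊆Γ = ⊥E (Der𝒩⇒NJ d (⊆-++[] P⊆Γ))
Der𝒩⇒NJ (app _ (∧I _ _) (d ∷ e ∷ []))         P⊆Γ =
  ∧I (Der𝒩⇒NJ d (⊆-++[] P⊆Γ)) (Der𝒩⇒NJ e (⊆-++[] P⊆Γ))
Der𝒩⇒NJ (app _ (∧E₁ _ _) (d ∷ []))            P⊆Γ = ∧E₁ (Der𝒩⇒NJ d (⊆-++[] P⊆Γ))
Der𝒩⇒NJ (app _ (∧E₂ _ _) (d ∷ []))            P⊆Γ = ∧E₂ (Der𝒩⇒NJ d (⊆-++[] P⊆Γ))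
Der𝒩⇒NJ (app _ (∨I₁ _ _) (d ∷ []))            P⊆Γ = ∨I₁ (Der𝒩⇒NJ d (⊆-++[] P⊆Γ))
Der𝒩⇒NJ (app _ (∨I₂ _ _) (d ∷ []))            P⊆Γ = ∨I₂ (Der𝒩⇒NJ d (⊆-++[] P⊆Γ))
Der𝒩⇒NJ (app _ (∨E _ _ _) (d ∷ e ∷ f ∷ []))   P⊆Γ =
  ∨E (Der𝒩⇒NJ d (⊆-++[] P⊆Γ)) (Der𝒩⇒NJ e (⊆-∷ʳ P⊆Γ)) (Der𝒩⇒NJ f (⊆-∷ʳ P⊆Γ))
Der𝒩⇒NJ (app _ (⊃I _ _) (d ∷ []))             P⊆Γ = ⊃I (Der𝒩⇒NJ d (⊆-∷ʳ P⊆Γ))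
Der𝒩⇒NJ (app _ (⊃E _ _) (d ∷ e ∷ []))         P⊆Γ =
  ⊃E (Der𝒩⇒NJ d (⊆-++[] P⊆Γ)) (Der𝒩⇒NJ e (⊆-++[] P⊆Γ))

proposition15 : (Φ : List Form) (ψ : Form) → SuppFrom Φ 𝒩 ψ → Φ ⊢NJ ψ
proposition15 []        ψ ⊩ψ  = Der𝒩⇒NJ (Supp⇒Der ψ ⊆B-refl ⊩ψ) λ ()
proposition15 Φ@(_ ∷ _) ψ Φ⊩ψ = Der𝒩⇒NJ (Der-discharge₀ ♭Φ⊢ψ) ⊆-refl
  where
  ♭Φ⊢ψ : Der (𝒩 ⊕ ♭s Φ) [] (♭ ψ)
  ♭Φ⊢ψ = Supp⇒Der ψ ⊆B-⊕ (Φ⊩ψ _ ⊆B-⊕ (Supp-axioms Φ ⊆B-refl))
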